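{- Let $q$ be a prime power and let $(\star)$ be a linear system with coefficient matrix $A=(a_{ij})\in\mathbb{F}_q^{m\times k}$ that is non-degenerate and irreducible, with $m\ge 2$, and let $\ell$ be the number of column equivalence classes of $A$. Then every nonzero vector in the row space of $A$ has nonzero entries in indices belonging to at least two different column equivalence classes, and $\ell\ge m+1$.
   Context: Indices $j,j'\in[k]$ are equivalent if the $j$-th and $j'$-th columns of $A$ are nonzero scalar multiples of one another; the classes are the column equivalence classes. $(\star)$ is non-degenerate if the rows of $A$ are linearly independent and every column of $A$ is nonzero. Two linear systems are equivalent if each equation of either is a linear combination of the equations of the other. $(\star)$ is reducible if it is equivalent to a system whose variables can be partitioned into two or more classes such that every equation only uses (has nonzero coefficients on) variables from one class; otherwise it is irreducible. -}

module Defs where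

open import Level using (Level; _⊔_)
open import Algebra.Bundles using (CommutativeRing)
import Algebra.Definitions.RawMonoid as RM
open import Data.Nat using (ℕ; suc; _≤_)
open import Data.Nat.Primality using (Prime)
open import Data.Fin using (Fin)
open import Data.Product using (Σ; ∃; ∃-syntax; _×_; _,_)
open import Relation.Nullary using (¬_)
open import Relation.Binary.PropositionalEquality using (_≡_)

record Field (c ℓ : Level) : Set (Level.suc (c ⊔ ℓ)) where
  field
    commutativeRing : CommutativeRing c ℓ
  open CommutativeRing commutativeRing public
  field
    1≉0     : ¬ (1# ≈ 0#)
    inverse : ∀ x → ¬ (x ≈ 0#) → ∃[ y ] (x * y ≈ 1#)

PrimePower : ℕ → Set
PrimePower q = ∃[ p ] ∃[ n ] (Prime p × 1 ≤ n × q ≡ p Data.Nat.^ n)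

module _ {c ℓ : Level} (F : Field c ℓ) where
  open Field F
  open RM +-rawMonoid using (sum)

  HasOrder : ℕ → Set (c ⊔ ℓ)
  HasOrder q = Σ (Carrier → Fin q) λ f → Σ (Fin q → Carrier) λ g →
    (∀ {x y} → x ≈ y → f x ≡ f y) ×
    (∀ i → f (g i) ≡ i) ×
    (∀ x → g (f x) ≈ x)

  Matrix : ℕ → ℕ → Set c
  Matrix m k = Fin m → Fin k → Carrier

  rowComb : ∀ {m k} → Matrix m k → (Fin m → Carrier) → Fin k → Carrier
  rowComb A cs j = sum (λ i → cs i * A i j)

  InRowSpace : ∀ {m k} → Matrix m k → (Fin k → Carrier) → Set (c ⊔ ℓ)
  InRowSpace A v = ∃[ cs ] (∀ j → rowComb A cs j ≈ v j)

  NonzeroVec : ∀ {k} → (Fin k → Carrier) → Set ℓ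
  NonzeroVec v = ∃[ j ] (¬ (v j ≈ 0#))

  NonDegenerate : ∀ {m k} → Matrix m k → Set (c ⊔ ℓ)
  NonDegenerate A =
    (∀ cs → (∀ j → rowComb A cs j ≈ 0#) → ∀ i → cs i ≈ 0#) ×
    (∀ j → ∃[ i ] (¬ (A i j ≈ 0#)))

  ColEquiv : ∀ {m k} → Matrix m k → Fin k → Fin k → Set (c ⊔ ℓ)
  ColEquiv A j j' = ∃[ λ′ ] (¬ (λ′ ≈ 0#) × (∀ i → A i j ≈ λ′ * A i j'))

  NumColClasses : ∀ {m k} → Matrix m k → ℕ → Set (c ⊔ ℓ)
  NumColClasses {k = k} A ℓ′ = Σ (Fin k → Fin ℓ′) λ cls →
    (∀ t → ∃[ j ] (cls j ≡ t)) ×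
    (∀ j j' → ColEquiv A j j' → cls j ≡ cls j') ×
    (∀ j j' → cls j ≡ cls j' → ColEquiv A j j')

  EquivSystems : ∀ {m m' k} → Matrix m k → Matrix m' k → Set (c ⊔ ℓ)
  EquivSystems A B =
    (∀ i → InRowSpace A (B i)) × (∀ i → InRowSpace B (A i))

  Reducible : ∀ {m k} → Matrix m k → Set (c ⊔ ℓ)
  Reducible {k = k} A = ∃[ m' ] Σ (Matrix m' k) λ B → EquivSystems A B ×
    ∃[ r ] (2 ≤ r × Σ (Fin k → Fin r) λ p →
      (∀ t → ∃[ j ] (p j ≡ t)) ×
      (∀ i → ∃[ t ] (∀ j → ¬ (B i j ≈ 0#) → p j ≡ t)))

  Irreducible : ∀ {m k} → Matrix m k → Set (c ⊔ ℓ)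
  Irreducible A = ¬ Reducible A

-- If a nonzero vector v of the row space of A were supported in a single
-- column class, say that of a pivot j₀ with v j₀ ≠ 0, then adjoining v as a row
-- and clearing column j₀ of the other rows with it (one step of Gaussian
-- elimination) gives an equivalent system in which v only uses that class and
-- every other row only uses the remaining classes; the remaining classes are
-- nonempty because two independent rows cannot have all columns proportional.
-- This contradicts irreducibility.  For the bound, if there were ℓ ≤ m classes,
-- a nonzero combination of the rows of A vanishing on one representative of
-- each of ℓ - 1 classes vanishes on those whole classes, so it is a nonzero
-- vector of the row space supported in a single class.
module Submission where

open import Defs
open import Level using (Level)
open import Data.Nat using (ℕ; zero; suc; _≤_; _<_; _^_; z≤n; s≤s)
open import Data.Nat.Properties using (^-monoʳ-<; ≰⇒>)
import Data.Nat.Properties as ℕₚ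
open import Data.Fin using (Fin; zero; suc; _≟_; fromℕ<; combine; funToFin; finToFun)
open import Data.Fin.Properties
  using (pigeonhole; <⇒≢; ¬∀⟶∃¬; any?; all?; finToFun-funToFin; funToFin-finToFin)
open import Data.Product using (∃-syntax; _×_; _,_; proj₁; proj₂)
open import Function using (_∘_; case_of_)
open import Relation.Nullary using (¬_; Dec; yes; no; contradiction)
open import Relation.Nullary.Decidable using (¬?; _×-dec_; decidable-stable)
open import Relation.Binary.PropositionalEquality as ≡ using (_≡_; _≢_)

funToFin-cong : ∀ {m n} (u v : Fin m → Fin n) → (∀ i → u i ≡ v i) → funToFin u ≡ funToFin v
funToFin-cong {zero}  u v u≗v = ≡.refl
funToFin-cong {suc m} u v u≗v = ≡.cong₂ combine (u≗v zero) (funToFin-cong (u ∘ suc) (v ∘ suc) (u≗v ∘ suc))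

distinct⇒1<n : ∀ {n} {i j : Fin n} → i ≢ j → 1 < n
distinct⇒1<n {suc zero}    {zero} {zero} i≢j = contradiction ≡.refl i≢j
distinct⇒1<n {suc (suc n)}                _   = s≤s (s≤s z≤n)

indicator : ∀ {p} {X : Set p} → Dec X → Fin 2
indicator (yes _) = zero
indicator (no _)  = suc zero

indicator-yes : ∀ {p} {X : Set p} → X → (X? : Dec X) → indicator X? ≡ zero
indicator-yes x (yes _) = ≡.refl
indicator-yes x (no ¬x) = contradiction x ¬x

indicator-no : ∀ {p} {X : Set p} → ¬ X → (X? : Dec X) → indicator X? ≡ suc zero
indicator-no ¬x (yes x) = contradiction x ¬x
indicator-no ¬x (no _)  = ≡.refl

module RowOperations {c ℓ : Level} (F : Field c ℓ) where
  open Field F hiding (zero)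
  open import Algebra.Properties.Semiring.Sum semiring
    using (sum; sum-cong-≋; sum-replicate-zero; ∑-distrib-+; *-distribˡ-sum)
  open import Algebra.Properties.Group +-group using (//-rightDividesʳ)
  open import Algebra.Properties.Ring ring using (-‿distribˡ-*)
  open import Algebra.Properties.CommutativeSemigroup *-commutativeSemigroup
    using (x∙yz≈y∙xz; interchange)
  open import Relation.Binary.Reasoning.Setoid setoid

  RowsIndependent : ∀ {m k} → Matrix F m k → Set (c Level.⊔ ℓ)
  RowsIndependent A = ∀ cs → (∀ j → rowComb F A cs j ≈ 0#) → ∀ i → cs i ≈ 0#

  unitVec : ∀ {m} → Fin m → Fin m → Carrier
  unitVec zero    zero    = 1#
  unitVec zero    (suc _) = 0#
  unitVec (suc _) zero    = 0#
  unitVec (suc i) (suc j) = unitVec i j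

  sum-zero : ∀ {n} (x : Fin n → Carrier) → (∀ i → x i ≈ 0#) → sum x ≈ 0#
  sum-zero {n} x x≈0 = trans (sum-cong-≋ x≈0) (sum-replicate-zero n)

  rowComb-unitVec : ∀ {m k} (A : Matrix F m k) i j → rowComb F A (unitVec i) j ≈ A i j
  rowComb-unitVec A zero j = begin
    1# * A zero j + rowComb F (A ∘ suc) (λ _ → 0#) j
      ≈⟨ +-cong (*-identityˡ _) (sum-zero (λ i → 0# * A (suc i) j) (λ _ → zeroˡ _)) ⟩
    A zero j + 0#                                    ≈⟨ +-identityʳ _ ⟩
    A zero j                                         ∎
  rowComb-unitVec A (suc i) j = begin
    0# * A zero j + rowComb F (A ∘ suc) (unitVec i) j ≈⟨ +-cong (zeroˡ _) (rowComb-unitVec (A ∘ suc) i j) ⟩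
    0# + A (suc i) j                                  ≈⟨ +-identityˡ _ ⟩
    A (suc i) j                                       ∎

  rowComb-linear : ∀ {m k} (A : Matrix F m k) cs ds a j →
    rowComb F A (λ i → cs i + a * ds i) j ≈ rowComb F A cs j + a * rowComb F A ds j
  rowComb-linear A cs ds a j = begin
    sum (λ i → (cs i + a * ds i) * A i j)
      ≈⟨ sum-cong-≋ (λ i → trans (distribʳ (A i j) (cs i) (a * ds i)) (+-cong refl (*-assoc a (ds i) (A i j)))) ⟩
    sum (λ i → cs i * A i j + a * (ds i * A i j))
      ≈⟨ ∑-distrib-+ (λ i → cs i * A i j) (λ i → a * (ds i * A i j)) ⟩
    rowComb F A cs j + sum (λ i → a * (ds i * A i j))
      ≈⟨ +-cong refl (*-distribˡ-sum a (λ i → ds i * A i j)) ⟨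
    rowComb F A cs j + a * rowComb F A ds j       ∎

  rowComb-proportional : ∀ {m k} (A : Matrix F m k) cs {j j'} l →
    (∀ i → A i j ≈ l * A i j') → rowComb F A cs j ≈ l * rowComb F A cs j'
  rowComb-proportional A cs {j} {j'} l col≈ = begin
    sum (λ i → cs i * A i j)        ≈⟨ sum-cong-≋ (λ i → trans (*-cong refl (col≈ i)) (x∙yz≈y∙xz _ _ _)) ⟩
    sum (λ i → l * (cs i * A i j')) ≈⟨ *-distribˡ-sum l (λ i → cs i * A i j') ⟨
    l * rowComb F A cs j'           ∎

  rowComb-colEquiv : ∀ {m k} (A : Matrix F m k) cs {j j'} → ColEquiv F A j j' →
    rowComb F A cs j' ≈ 0# → rowComb F A cs j ≈ 0#
  rowComb-colEquiv A cs (l , _ , col≈) v≈0 =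
    trans (rowComb-proportional A cs l col≈) (trans (*-cong refl v≈0) (zeroʳ l))

  shear : ∀ {m k} → Matrix F m k → (Fin m → Carrier) → (Fin k → Carrier) → Matrix F (suc m) k
  shear A β v zero    j = v j
  shear A β v (suc i) j = A i j + β i * v j

  shear-equivalent : ∀ {m k} (A : Matrix F m k) β v → InRowSpace F A v → EquivSystems F A (shear A β v)
  shear-equivalent A β v (cs , cs↦v) = sheared-in-A , A-in-sheared
    where
    sheared-in-A : ∀ i → InRowSpace F A (shear A β v i)
    sheared-in-A zero    = cs , cs↦v
    sheared-in-A (suc i) = (λ i' → unitVec i i' + β i * cs i') , λ j → begin
      rowComb F A (λ i' → unitVec i i' + β i * cs i') j ≈⟨ rowComb-linear A (unitVec i) cs (β i) j ⟩
      rowComb F A (unitVec i) j + β i * rowComb F A cs j ≈⟨ +-cong (rowComb-unitVec A i j) (*-cong refl (cs↦v j)) ⟩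
      A i j + β i * v j                                  ∎
    A-in-sheared : ∀ i → InRowSpace F (shear A β v) (A i)
    A-in-sheared i = ds , λ j → begin
      - β i * v j + rowComb F (shear A β v ∘ suc) (unitVec i) j
        ≈⟨ +-cong (sym (-‿distribˡ-* _ _)) (rowComb-unitVec (shear A β v ∘ suc) i j) ⟩
      - (β i * v j) + (A i j + β i * v j)                         ≈⟨ +-comm _ _ ⟩
      (A i j + β i * v j) - β i * v j                             ≈⟨ //-rightDividesʳ _ _ ⟩
      A i j                                                       ∎
      where
      ds : Fin (suc _) → Carrier
      ds zero    = - β i
      ds (suc i') = unitVec i i'

  -- With w = (v j₀)⁻¹ this is the elimination step using the pivot v j₀.
  clearingCoeffs : ∀ {m k} → Matrix F m k → Fin k → Carrier → Fin m → Carrier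
  clearingCoeffs A j₀ w i = - (A i j₀ * w)

  shear-clears-colEquiv : ∀ {m k} (A : Matrix F m k) v {j j₀ w} →
    InRowSpace F A v → v j₀ * w ≈ 1# → ColEquiv F A j j₀ →
    ∀ i → shear A (clearingCoeffs A j₀ w) v (suc i) j ≈ 0#
  shear-clears-colEquiv A v {j} {j₀} {w} (cs , cs↦v) vw≈1 (l , _ , col≈) i = begin
    A i j + - (a * w) * v j         ≈⟨ +-cong (col≈ i) (*-cong refl v-proportional) ⟩
    l * a + - (a * w) * (l * u)     ≈⟨ +-cong refl (sym (-‿distribˡ-* _ _)) ⟩
    l * a + - ((a * w) * (l * u))   ≈⟨ +-cong refl (-‿cong rearranged) ⟩
    l * a + - ((l * a) * (u * w))   ≈⟨ +-cong refl (-‿cong (trans (*-cong refl vw≈1) (*-identityʳ _))) ⟩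
    l * a - l * a                   ≈⟨ -‿inverseʳ _ ⟩
    0#                              ∎
    where
    a = A i j₀
    u = v j₀
    v-proportional : v j ≈ l * u
    v-proportional = trans (sym (cs↦v j)) (trans (rowComb-proportional A cs l col≈) (*-cong refl (cs↦v j₀)))
    rearranged : (a * w) * (l * u) ≈ (l * a) * (u * w)
    rearranged = trans (interchange a w l u) (*-cong (*-comm a l) (*-comm w u))

module FiniteField {c ℓ : Level} (F : Field c ℓ) {q : ℕ} (order : HasOrder F q) where
  open Field F hiding (zero)
  open RowOperations F
  open import Algebra.Properties.Group +-group using (x∙y⁻¹≈ε⇒x≈y; x≈y⇒x∙y⁻¹≈ε)
  open import Algebra.Properties.Ring ring using (-1*x≈-x)
  open import Relation.Binary.Reasoning.Setoid setoid

  encode : Carrier → Fin q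
  encode = proj₁ order

  decode : Fin q → Carrier
  decode = proj₁ (proj₂ order)

  encode-cong : ∀ {x y} → x ≈ y → encode x ≡ encode y
  encode-cong = proj₁ (proj₂ (proj₂ order))

  encode-decode : ∀ i → encode (decode i) ≡ i
  encode-decode = proj₁ (proj₂ (proj₂ (proj₂ order)))

  decode-encode : ∀ x → decode (encode x) ≈ x
  decode-encode = proj₂ (proj₂ (proj₂ (proj₂ order)))

  encode-injective : ∀ {x y} → encode x ≡ encode y → x ≈ y
  encode-injective {x} {y} eq = trans (sym (decode-encode x)) (trans (reflexive (≡.cong decode eq)) (decode-encode y))

  _≈?_ : ∀ x y → Dec (x ≈ y)
  x ≈? y with encode x ≟ encode y
  ... | yes eq  = yes (encode-injective eq)
  ... | no  neq = no (neq ∘ encode-cong)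

  1<q : 1 < q
  1<q = distinct⇒1<n (1≉0 ∘ encode-injective)

  ColEquiv? : ∀ {m k} (A : Matrix F m k) j j' → Dec (ColEquiv F A j j')
  ColEquiv? A j j' with any? (λ t → ¬? (decode t ≈? 0#) ×-dec all? (λ i → A i j ≈? (decode t * A i j')))
  ... | yes (t , t≉0 , col≈) = yes (decode t , t≉0 , col≈)
  ... | no  none             = no λ (l , l≉0 , col≈) →
    none (encode l , (l≉0 ∘ trans (sym (decode-encode l))) , λ i → trans (col≈ i) (*-cong (sym (decode-encode l)) refl))

  coefficients : ∀ {m} → Fin (q ^ m) → Fin m → Carrier
  coefficients x = decode ∘ finToFun x

  coefficients-differ : ∀ {m} {x y : Fin (q ^ m)} → x ≢ y → ∃[ i ] ¬ (coefficients x i ≈ coefficients y i)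
  coefficients-differ {m} {x} {y} x≢y = ¬∀⟶∃¬ m _ (λ i → coefficients x i ≈? coefficients y i) λ coeffs≈ →
    x≢y (≡.trans (≡.sym (funToFin-finToFin {m} {q} x))
          (≡.trans (funToFin-cong (finToFun x) (finToFun y) (λ i → ≡.trans (≡.sym (encode-decode _))
                                            (≡.trans (encode-cong (coeffs≈ i)) (encode-decode _))))
                   (funToFin-finToFin {m} {q} y)))

  encodedCombination : ∀ {m k} → Matrix F m k → Fin (q ^ m) → Fin (q ^ k)
  encodedCombination A x = funToFin (λ j → encode (rowComb F A (coefficients x) j))

  encodedCombination-injective : ∀ {m k} (A : Matrix F m k) {x y} → encodedCombination A x ≡ encodedCombination A y →
    ∀ j → rowComb F A (coefficients x) j ≈ rowComb F A (coefficients y) j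
  encodedCombination-injective A same j = encode-injective
    (≡.trans (≡.sym (finToFun-funToFin _ j)) (≡.trans (≡.cong (λ z → finToFun z j) same) (finToFun-funToFin _ j)))

  -- Pigeonhole on the q ^ m coefficient vectors versus the q ^ k possible combinations.
  combinations-collide : ∀ {m k} → k < m → (A : Matrix F m k) →
    ∃[ as ] ∃[ bs ] (∃[ i ] ¬ (as i ≈ bs i)) × (∀ j → rowComb F A as j ≈ rowComb F A bs j)
  combinations-collide k<m A
    with x , y , x<y , same ← pigeonhole (^-monoʳ-< q 1<q k<m) (encodedCombination A)
    = coefficients x , coefficients y , coefficients-differ (<⇒≢ x<y) , encodedCombination-injective A same

  rows-dependent : ∀ {m k} → k < m → (A : Matrix F m k) →
    ∃[ cs ] NonzeroVec F cs × (∀ j → rowComb F A cs j ≈ 0#)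
  rows-dependent k<m A with as , bs , (i , as≉bs) , as≈bs ← combinations-collide k<m A =
    (λ i → as i + - 1# * bs i) ,
    (i , as≉bs ∘ x∙y⁻¹≈ε⇒x≈y _ _ ∘ trans (+-cong refl (sym (-1*x≈-x _)))) ,
    λ j → begin
      rowComb F A (λ i → as i + - 1# * bs i) j            ≈⟨ rowComb-linear A as bs (- 1#) j ⟩
      rowComb F A as j + - 1# * rowComb F A bs j          ≈⟨ +-cong refl (-1*x≈-x _) ⟩
      rowComb F A as j - rowComb F A bs j                 ≈⟨ x≈y⇒x∙y⁻¹≈ε (as≈bs j) ⟩
      0#                                                  ∎

  module _ {m k} (A : Matrix F m k) (2≤m : 2 ≤ m) (independent : RowsIndependent A) where

    rowComb-nonzero : ∀ cs → NonzeroVec F cs → NonzeroVec F (rowComb F A cs)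
    rowComb-nonzero cs (i , cs-i≉0) =
      ¬∀⟶∃¬ k _ (λ j → rowComb F A cs j ≈? 0#) λ all≈0 → cs-i≉0 (independent cs all≈0 i)

    some-column-not-colEquiv : ∀ j₀ → ∃[ j ] ¬ ColEquiv F A j j₀
    some-column-not-colEquiv j₀ = ¬∀⟶∃¬ k _ (λ j → ColEquiv? A j j₀) λ all-colEquiv →
      let cs , (i , cs-i≉0) , vanishes = rows-dependent 2≤m (λ i _ → A i j₀)
      in cs-i≉0 (independent cs (λ j → rowComb-colEquiv A cs (all-colEquiv j) (vanishes zero)) i)

    reducible-if-supported-in-class : ∀ v {j₀} → InRowSpace F A v → ¬ (v j₀ ≈ 0#) →
      (∀ j → ¬ (v j ≈ 0#) → ColEquiv F A j j₀) → Reducible F A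
    reducible-if-supported-in-class v {j₀} v∈A vj₀≉0 supported =
      suc m , shear A (clearingCoeffs A j₀ w) v , shear-equivalent A _ v v∈A ,
      2 , ℕₚ.≤-refl , inClass , onto , uses-one-part
      where
      w = proj₁ (inverse (v j₀) vj₀≉0)
      vw≈1 : v j₀ * w ≈ 1#
      vw≈1 = proj₂ (inverse (v j₀) vj₀≉0)
      inClass : Fin k → Fin 2
      inClass j = indicator (ColEquiv? A j j₀)
      onto : ∀ t → ∃[ j ] (inClass j ≡ t)
      onto zero       = j₀ , indicator-yes (1# , 1≉0 , λ _ → sym (*-identityˡ _)) (ColEquiv? A j₀ j₀)
      onto (suc zero) = let j , ¬colEquiv = some-column-not-colEquiv j₀
                        in j , indicator-no ¬colEquiv (ColEquiv? A j j₀)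
      uses-one-part : ∀ i → ∃[ t ] (∀ j → ¬ (shear A (clearingCoeffs A j₀ w) v i j ≈ 0#) → inClass j ≡ t)
      uses-one-part zero    = zero , λ j vj≉0 → indicator-yes (supported j vj≉0) (ColEquiv? A j j₀)
      uses-one-part (suc i) = suc zero , λ j entry≉0 →
        indicator-no (λ colEquiv → entry≉0 (shear-clears-colEquiv A v v∈A vw≈1 colEquiv i)) (ColEquiv? A j j₀)

    module _ (irreducible : Irreducible F A) where

      support-meets-two-classes : ∀ v → InRowSpace F A v → NonzeroVec F v →
        ∃[ j ] ∃[ j' ] (¬ (v j ≈ 0#) × ¬ (v j' ≈ 0#) × ¬ ColEquiv F A j j')
      support-meets-two-classes v v∈A (j₀ , vj₀≉0)
        with any? (λ j → any? (λ j' → ¬? (v j ≈? 0#) ×-dec (¬? (v j' ≈? 0#) ×-dec ¬? (ColEquiv? A j j'))))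
      ... | yes pair = pair
      ... | no  none = contradiction
        (reducible-if-supported-in-class v v∈A vj₀≉0 λ j vj≉0 →
          decidable-stable (ColEquiv? A j j₀) λ ¬colEquiv → none (j , j₀ , vj≉0 , vj₀≉0 , ¬colEquiv))
        irreducible

      classes≰rows : ∀ ℓ′ → NumColClasses F A ℓ′ → ¬ (ℓ′ ≤ m)
      classes≰rows zero (cls , _) _ = 1≉0 (independent (λ _ → 1#) (λ j → case cls j of λ ()) (fromℕ< 2≤m))
      classes≰rows (suc n) (cls , onto , _ , same⇒colEquiv) n<m =
        let cs , cs≢0 , vanishes = rows-dependent n<m (λ i t → A i (rep t))
            j , j' , vj≉0 , vj'≉0 , ¬colEquiv =
              support-meets-two-classes (rowComb F A cs) (cs , λ _ → refl) (rowComb-nonzero cs cs≢0)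
        in ¬colEquiv (same⇒colEquiv j j'
             (≡.trans (in-class-zero cs vanishes j vj≉0) (≡.sym (in-class-zero cs vanishes j' vj'≉0))))
        where
        rep : Fin n → Fin k
        rep t = proj₁ (onto (suc t))
        in-class-zero : ∀ cs → (∀ t → rowComb F A cs (rep t) ≈ 0#) →
          ∀ j → ¬ (rowComb F A cs j ≈ 0#) → cls j ≡ zero
        in-class-zero cs vanishes j vj≉0 with cls j in eq
        ... | zero  = ≡.refl
        ... | suc t = contradiction
          (rowComb-colEquiv A cs (same⇒colEquiv j (rep t) (≡.trans eq (≡.sym (proj₂ (onto (suc t)))))) (vanishes t))
          vj≉0

open import Data.Nat using (_+_)

proposition2p3 : ∀ {c ℓ : Level} (F : Field c ℓ) (q : ℕ) → PrimePower q → HasOrder F q →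
    ∀ {m k : ℕ} (A : Matrix F m k) → 2 ≤ m → NonDegenerate F A → Irreducible F A →
    (∀ v → InRowSpace F A v → NonzeroVec F v →
      ∃[ j ] ∃[ j' ] (¬ (Field._≈_ F (v j) (Field.0# F)) × ¬ (Field._≈_ F (v j') (Field.0# F)) × ¬ ColEquiv F A j j'))
    × (∀ ℓ′ → NumColClasses F A ℓ′ → m + 1 ≤ ℓ′)
proposition2p3 F q _ order {m} A 2≤m (independent , _) irreducible =
  support-meets-two-classes A 2≤m independent irreducible ,
  λ ℓ′ classes →
    ≡.subst (_≤ ℓ′) (ℕₚ.+-comm 1 m) (≰⇒> (classes≰rows A 2≤m independent irreducible ℓ′ classes))
  where open FiniteField F order
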